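{- If $l>0$, then for each $0\le r<k-l$ the subgraph $\mathcal{P}_r$ is an induced path of $IJ(S,k,l)$. Moreover, $IJ(S,k,l)$ is the union of $\{\mathcal{P}_r \mid 0\le r<k-l\}$.
   Context: Let $S$ be a set of $n-1$ points $x_1<x_2<\cdots<x_{n-1}$ on the real line (a horizontal line), and let $0\le l<k$ be integers. A subset $I\subseteq S$ is an island if $I=S\cap C$ for some convex set $C$; a $k$-island is an island with $k$ elements. The $k$-islands of $S$ are exactly the $k$-intervals, i.e. sets $\{x_i,\ldots,x_{i+k-1}\}$ of $k$ consecutive elements. The generalized island Johnson graph $IJ(S,k,l)$ has as vertices the $k$-intervals of $S$, two being adjacent if their intersection has exactly $l$ elements. For $0\le r<k-l$, $\mathcal{P}_r$ denotes the subgraph of $IJ(S,k,l)$ induced by those $k$-intervals whose last (right-most) point $x_i$ has index $i\equiv r \pmod{k-l}$. -}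

module Defs where

open import Data.Nat using (ℕ; zero; suc; _+_; _∸_; _≤_; _<_; _≤?_; _<?_; ∣_-_∣; NonZero)
open import Data.Nat.DivMod using (_%_)
open import Data.Fin using (Fin; toℕ)
open import Data.List using (List; length; filter; upTo)
open import Data.Product using (_×_; ∃; ∃-syntax; Σ)
open import Relation.Nullary.Decidable using (_×-dec_)
open import Relation.Binary.PropositionalEquality using (_≡_)
open import Function.Bundles using (_⇔_)
open import Function.Definitions using (Injective)

-- The point set S = {x_1 < ... < x_{n-1}} is identified with its index set {1,...,n-1}.
-- A k-interval (= k-island) is identified by the index i of its last point:
-- it is {x_{i-k+1}, ..., x_i}, and exists iff k ≤ i ≤ n-1, i.e. k ≤ i < n.
IsVertex : (n k i : ℕ) → Set
IsVertex n k i = k ≤ i × i < n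

InInterval : (k i m : ℕ) → Set
InInterval k i m = m ≤ i × i < m + k

-- number of points of S (indices 1..n-1; index 0 never lies in an interval) in both intervals
interSize : (n k i j : ℕ) → ℕ
interSize n k i j =
  length (filter (λ m → ((m ≤? i) ×-dec (i <? m + k)) ×-dec ((m ≤? j) ×-dec (j <? m + k))) (upTo n))

Adj : (n k l i j : ℕ) → Set
Adj n k l i j = interSize n k i j ≡ l

InP : (n k l r : ℕ) → {{NonZero (k ∸ l)}} → ℕ → Set
InP n k l r i = IsVertex n k i × i % (k ∸ l) ≡ r

IsInducedPath : (V : ℕ → Set) (A : ℕ → ℕ → Set) → Set
IsInducedPath V A =
  ∃[ m ] Σ (Fin m → ℕ) λ f →
    Injective _≡_ _≡_ f
    × (∀ a → V (f a))
    × (∀ v → V v → ∃[ a ] f a ≡ v)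
    × (∀ a b → A (f a) (f b) ⇔ (∣ toℕ a - toℕ b ∣ ≡ 1))

module Submission where

-- A k-interval of S = {x_1 < ... < x_{n-1}} is identified with the index i
-- of its right-most point (k ≤ i < n).  With d = k - l the proof runs:
--
--  (1) Counting.  A decidable predicate holding exactly on [a, b) has
--      (n ⊓ b) ∸ a witnesses in [0, n).
--  (2) Overlap.  The k-intervals ending at i ≤ j share exactly the points
--      j+1-k, ..., i; by (1) they share k ∸ |i - j| points.  Hence, for
--      0 < l ≤ k, two k-intervals are adjacent in IJ(S,k,l) iff their right
--      ends are at distance d.
--  (3) Progressions.  For r < d the numbers ≡ r (mod d) are the terms
--      r + q·d; those in a window [a, b) are the terms with q in a run of
--      consecutive indices (bounded by least-number thresholds).  Two terms
--      are at distance d iff their indices are consecutive, so every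
--      relation meaning "distance d" on the window makes it an induced path.
--
-- P_r is the window [k, n) of the residue class r, so (2) and (3) make it an
-- induced path; every vertex i lies in P_(i mod d); and adjacent vertices,
-- being at distance d, have equal residues mod d.

open import Defs
open import Data.Nat using (ℕ; zero; suc; _+_; _*_; _∸_; _⊓_; _≤_; _<_; _≤?_; _<?_; s≤s; NonZero; ∣_-_∣)
open import Data.Nat.Properties
open import Data.Nat.DivMod using (_%_; _/_; m≡m%n+[m/n]*n; [m+kn]%n≡m%n; [m+n]%n≡m%n; m<n⇒m%n≡m; m%n<n)
open import Data.Fin using (Fin; toℕ; fromℕ<)
open import Data.Fin.Properties using (toℕ<n; toℕ-injective; toℕ-fromℕ<)
open import Data.List using (length; filter; upTo; [_]; _++_)
open import Data.List.Properties using (upTo-∷ʳ; filter-++; length-++; filter-accept; filter-reject; filter-≐)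
open import Data.Product using (_×_; _,_; proj₁; proj₂; ∃-syntax; swap)
open import Data.Sum using (_⊎_; inj₁; inj₂)
open import Relation.Nullary using (¬_; yes; no; contradiction)
open import Relation.Nullary.Decidable using (_×-dec_)
open import Relation.Unary using (Decidable)
open import Relation.Binary.PropositionalEquality using (_≡_; refl; sym; trans; cong; subst; module ≡-Reasoning)
open import Function.Bundles using (_⇔_; mk⇔; Equivalence)

open Equivalence using (to; from)

-- (1) Counting the elements of an interval.

count : {P : ℕ → Set} → Decidable P → ℕ → ℕ
count P? n = length (filter P? (upTo n))

module _ {P : ℕ → Set} (P? : Decidable P) where

  count-step : ∀ n → count P? (suc n) ≡ count P? n + length (filter P? [ n ])
  count-step n = begin
    length (filter P? (upTo (suc n)))               ≡⟨ cong (λ xs → length (filter P? xs)) (sym (upTo-∷ʳ n)) ⟩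
    length (filter P? (upTo n ++ [ n ]))            ≡⟨ cong length (filter-++ P? (upTo n) [ n ]) ⟩
    length (filter P? (upTo n) ++ filter P? [ n ])  ≡⟨ length-++ (filter P? (upTo n)) ⟩
    count P? n + length (filter P? [ n ])           ∎
    where open ≡-Reasoning

  count-accept : ∀ {n} → P n → count P? (suc n) ≡ suc (count P? n)
  count-accept {n} p =
    trans (count-step n) (trans (cong (λ xs → count P? n + length xs) (filter-accept P? p)) (+-comm _ 1))

  count-reject : ∀ {n} → ¬ P n → count P? (suc n) ≡ count P? n
  count-reject {n} ¬p =
    trans (count-step n) (trans (cong (λ xs → count P? n + length xs) (filter-reject P? ¬p)) (+-identityʳ _))

  count-interval : ∀ {a b} → (∀ {m} → P m ⇔ (a ≤ m × m < b)) → ∀ n → count P? n ≡ (n ⊓ b) ∸ a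
  count-interval {a} {b} P⇔ zero = sym (0∸n≡0 a)
  count-interval {a} {b} P⇔ (suc n) with n <? b | a ≤? n
  ... | yes n<b | yes a≤n = begin
    count P? (suc n)     ≡⟨ count-accept (from P⇔ (a≤n , n<b)) ⟩
    suc (count P? n)     ≡⟨ cong suc (count-interval P⇔ n) ⟩
    suc ((n ⊓ b) ∸ a)    ≡⟨ cong (λ x → suc (x ∸ a)) (m≤n⇒m⊓n≡m (<⇒≤ n<b)) ⟩
    suc (n ∸ a)          ≡⟨ +-∸-assoc 1 a≤n ⟨
    suc n ∸ a            ≡⟨ cong (_∸ a) (m≤n⇒m⊓n≡m n<b) ⟨
    (suc n ⊓ b) ∸ a      ∎
    where open ≡-Reasoning
  ... | yes n<b | no a≰n = begin
    count P? (suc n)     ≡⟨ count-reject (λ p → a≰n (proj₁ (to P⇔ p))) ⟩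
    count P? n           ≡⟨ count-interval P⇔ n ⟩
    (n ⊓ b) ∸ a          ≡⟨ cong (_∸ a) (m≤n⇒m⊓n≡m (<⇒≤ n<b)) ⟩
    n ∸ a                ≡⟨ m≤n⇒m∸n≡0 (<⇒≤ (≰⇒> a≰n)) ⟩
    0                    ≡⟨ m≤n⇒m∸n≡0 (≰⇒> a≰n) ⟨
    suc n ∸ a            ≡⟨ cong (_∸ a) (m≤n⇒m⊓n≡m n<b) ⟨
    (suc n ⊓ b) ∸ a      ∎
    where open ≡-Reasoning
  ... | no n≮b | _ = begin
    count P? (suc n)     ≡⟨ count-reject (λ p → n≮b (proj₂ (to P⇔ p))) ⟩
    count P? n           ≡⟨ count-interval P⇔ n ⟩
    (n ⊓ b) ∸ a          ≡⟨ cong (_∸ a) (m≥n⇒m⊓n≡n (≮⇒≥ n≮b)) ⟩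
    b ∸ a                ≡⟨ cong (_∸ a) (m≥n⇒m⊓n≡n (≤-trans (≮⇒≥ n≮b) (n≤1+n n))) ⟨
    (suc n ⊓ b) ∸ a      ∎
    where open ≡-Reasoning

-- (2) The overlap of two k-intervals.

shared? : ∀ k i j → Decidable (λ m → InInterval k i m × InInterval k j m)
shared? k i j m = ((m ≤? i) ×-dec (i <? m + k)) ×-dec ((m ≤? j) ×-dec (j <? m + k))

shared⇔ : ∀ {k i j m} → i ≤ j → k ≤ j →
  (InInterval k i m × InInterval k j m) ⇔ (suc j ∸ k ≤ m × m < suc i)
shared⇔ {k} {i} {j} {m} i≤j k≤j = mk⇔ in-range in-both
  where
  in-range : InInterval k i m × InInterval k j m → suc j ∸ k ≤ m × m < suc i
  in-range ((m≤i , _) , (_ , j<m+k)) = subst (suc j ∸ k ≤_) (m+n∸n≡m m k) (∸-monoˡ-≤ k j<m+k) , s≤s m≤i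

  in-both : suc j ∸ k ≤ m × m < suc i → InInterval k i m × InInterval k j m
  in-both (start≤m , s≤s m≤i) = (m≤i , ≤-trans (s≤s i≤j) j<m+k) , (≤-trans m≤i i≤j , j<m+k)
    where
    j<m+k : j < m + k
    j<m+k = subst (_≤ m + k) (m∸n+n≡m (≤-trans k≤j (n≤1+n j))) (+-monoˡ-≤ k start≤m)

interSize-sym : ∀ n k i j → interSize n k i j ≡ interSize n k j i
interSize-sym n k i j = cong length (filter-≐ (shared? k i j) (shared? k j i) (swap , swap) (upTo n))

overlap-length : ∀ {k i j} → i ≤ j → k ≤ j → suc i ∸ (suc j ∸ k) ≡ k ∸ (j ∸ i)
overlap-length {k} {i} {j} i≤j k≤j = begin
  suc i ∸ (suc j ∸ k)    ≡⟨ cong (suc i ∸_) (+-∸-assoc 1 k≤j) ⟩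
  i ∸ t                  ≡⟨ [m+n]∸[m+o]≡n∸o δ i t ⟨
  (δ + i) ∸ (δ + t)      ≡⟨ cong₂-∸ (trans (+-comm δ i) (m+[n∸m]≡n i≤j)) (+-comm δ t) ⟩
  j ∸ (t + δ)            ≡⟨ cong (_∸ (t + δ)) (m∸n+n≡m k≤j) ⟨
  (t + k) ∸ (t + δ)      ≡⟨ [m+n]∸[m+o]≡n∸o t k δ ⟩
  k ∸ δ                  ∎
  where
  open ≡-Reasoning
  t δ : ℕ
  t = j ∸ k
  δ = j ∸ i
  cong₂-∸ : ∀ {x y u v} → x ≡ y → u ≡ v → x ∸ u ≡ y ∸ v
  cong₂-∸ refl refl = refl

interSize-ordered : ∀ {n k i j} → i ≤ j → k ≤ j → i < n → interSize n k i j ≡ k ∸ (j ∸ i)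
interSize-ordered {n} {k} {i} {j} i≤j k≤j i<n = begin
  interSize n k i j             ≡⟨ count-interval (shared? k i j) (shared⇔ i≤j k≤j) n ⟩
  (n ⊓ suc i) ∸ (suc j ∸ k)     ≡⟨ cong (_∸ (suc j ∸ k)) (m≥n⇒m⊓n≡n i<n) ⟩
  suc i ∸ (suc j ∸ k)           ≡⟨ overlap-length i≤j k≤j ⟩
  k ∸ (j ∸ i)                   ∎
  where open ≡-Reasoning

interSize-distance : ∀ {n k i j} → IsVertex n k i → IsVertex n k j → interSize n k i j ≡ k ∸ ∣ i - j ∣
interSize-distance {n} {k} {i} {j} (k≤i , i<n) (k≤j , j<n) with ≤-total i j
... | inj₁ i≤j = trans (interSize-ordered i≤j k≤j i<n) (cong (k ∸_) (sym (m≤n⇒∣m-n∣≡n∸m i≤j)))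
... | inj₂ j≤i = trans (interSize-sym n k i j)
                   (trans (interSize-ordered j≤i k≤i j<n) (cong (k ∸_) (sym (m≤n⇒∣n-m∣≡n∸m j≤i))))

∸-hits-once : ∀ {k l δ} → 0 < l → l ≤ k → (k ∸ δ ≡ l ⇔ δ ≡ k ∸ l)
∸-hits-once {k} {l} {δ} 0<l l≤k = mk⇔
  (λ k∸δ≡l → trans (sym (m∸[m∸n]≡n (<⇒≤ (δ<k k∸δ≡l)))) (cong (k ∸_) k∸δ≡l))
  (λ { refl → m∸[m∸n]≡n l≤k })
  where
  δ<k : k ∸ δ ≡ l → δ < k
  δ<k k∸δ≡l = m∸n≢0⇒n<m (λ k∸δ≡0 → <⇒≢ 0<l (trans (sym k∸δ≡0) k∸δ≡l))

adjacent⇔distance : ∀ {n k l i j} → 0 < l → l ≤ k → IsVertex n k i → IsVertex n k j →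
  Adj n k l i j ⇔ (∣ i - j ∣ ≡ k ∸ l)
adjacent⇔distance {l = l} 0<l l≤k vi vj =
  subst (λ s → (s ≡ l) ⇔ _) (sym (interSize-distance vi vj)) (∸-hits-once 0<l l≤k)

residue-after : ∀ {d u v} .{{_ : NonZero d}} → u ≤ v → v ∸ u ≡ d → v % d ≡ u % d
residue-after {d} {u} {v} u≤v v∸u≡d = begin
  v % d              ≡⟨ cong (_% d) (m+[n∸m]≡n u≤v) ⟨
  (u + (v ∸ u)) % d  ≡⟨ cong (λ x → (u + x) % d) v∸u≡d ⟩
  (u + d) % d        ≡⟨ [m+n]%n≡m%n u d ⟩
  u % d              ∎
  where open ≡-Reasoning

same-residue-at-distance : ∀ {d} .{{_ : NonZero d}} i j → ∣ i - j ∣ ≡ d → i % d ≡ j % d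
same-residue-at-distance i j dist with ≤-total i j
... | inj₁ i≤j = sym (residue-after i≤j (trans (sym (m≤n⇒∣m-n∣≡n∸m i≤j)) dist))
... | inj₂ j≤i = residue-after j≤i (trans (sym (m≤n⇒∣n-m∣≡n∸m j≤i)) dist)

-- (3) Residue classes as arithmetic progressions.

Least : (ℕ → Set) → ℕ → Set
Least P q = P q × (∀ {q'} → q' < q → ¬ P q')

module _ {P : ℕ → Set} (P? : Decidable P) where

  least-below : ∀ N → (∃[ q ] Least P q) ⊎ (∀ {q} → q < N → ¬ P q)
  least-below zero = inj₂ λ ()
  least-below (suc N) with least-below N
  ... | inj₁ found = inj₁ found
  ... | inj₂ none with P? N
  ...   | yes p = inj₁ (N , p , none)
  ...   | no ¬p = inj₂ (λ q<1+N → below-or-at (m<1+n⇒m<n∨m≡n q<1+N))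
    where
    below-or-at : ∀ {q} → q < N ⊎ q ≡ N → ¬ P q
    below-or-at (inj₁ q<N) = none q<N
    below-or-at (inj₂ refl) = ¬p

  least : ∀ {N} → P N → ∃[ q ] Least P q
  least {N} pN with least-below (suc N)
  ... | inj₁ found = found
  ... | inj₂ none = contradiction pN (none (n<1+n N))

+-<-∸ : ∀ o {m n} → m < n ∸ o → o + m < n
+-<-∸ zero m<n = m<n
+-<-∸ (suc o) {n = suc n} m<n∸o = s≤s (+-<-∸ o m<n∸o)

*-≡-self⇔1 : ∀ x d .{{_ : NonZero d}} → (x * d ≡ d) ⇔ (x ≡ 1)
*-≡-self⇔1 x d = mk⇔ (λ e → *-cancelʳ-≡ x 1 d (trans e (sym (*-identityˡ d)))) (λ { refl → *-identityˡ d })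

module Progression (d r : ℕ) .{{_ : NonZero d}} (r<d : r < d) where

  term : ℕ → ℕ
  term q = r + q * d

  term-mono : ∀ {q q'} → q ≤ q' → term q ≤ term q'
  term-mono q≤q' = +-monoʳ-≤ r (*-monoˡ-≤ d q≤q')

  term-injective : ∀ {q q'} → term q ≡ term q' → q ≡ q'
  term-injective {q} {q'} e = *-cancelʳ-≡ q q' d (+-cancelˡ-≡ r _ _ e)

  term-residue : ∀ q → term q % d ≡ r
  term-residue q = trans ([m+kn]%n≡m%n r q d) (m<n⇒m%n≡m r<d)

  residue⇒term : ∀ {v} → v % d ≡ r → term (v / d) ≡ v
  residue⇒term {v} v%d≡r = sym (trans (m≡m%n+[m/n]*n v d) (cong (_+ (v / d) * d) v%d≡r))

  term-distance : ∀ x y → ∣ term x - term y ∣ ≡ ∣ x - y ∣ * d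
  term-distance x y = trans (∣m+n-m+o∣≡∣n-o∣ r (x * d) (y * d)) (sym (*-distribʳ-∣-∣ d x y))

  first-above : ∀ t → ∃[ q ] Least (λ q → t ≤ term q) q
  first-above t = least (λ q → t ≤? term q) {t} reaches
    where
    reaches : t ≤ term t
    reaches = ≤-trans (m≤m*n t d) (m≤n+m (t * d) r)

  threshold : ℕ → ℕ
  threshold t = proj₁ (first-above t)

  above⇔ : ∀ {t q} → (t ≤ term q) ⇔ (threshold t ≤ q)
  above⇔ {t} {q} = mk⇔
    (λ t≤term → ≮⇒≥ (λ q<th → minimal q<th t≤term))
    (λ th≤q → ≤-trans reached (term-mono th≤q))
    where
    reached : t ≤ term (threshold t)
    reached = proj₁ (proj₂ (first-above t))
    minimal : ∀ {q'} → q' < threshold t → ¬ (t ≤ term q')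
    minimal = proj₂ (proj₂ (first-above t))

  InWindow : ℕ → ℕ → ℕ → Set
  InWindow a b v = (a ≤ v × v < b) × v % d ≡ r

  term-in-window : ∀ {a b q} → InWindow a b (term q) ⇔ (threshold a ≤ q × q < threshold b)
  term-in-window {a} {b} {q} = mk⇔
    (λ ((a≤ , <b) , _) → to above⇔ a≤ , ≰⇒> (λ th≤q → <⇒≱ <b (from above⇔ th≤q)))
    (λ (th≤q , q<th) → (from above⇔ th≤q , ≰⇒> (λ b≤ → <⇒≱ q<th (to above⇔ b≤))) , term-residue q)

  window-is-path : ∀ a b (A : ℕ → ℕ → Set) →
    (∀ {u v} → InWindow a b u → InWindow a b v → A u v ⇔ (∣ u - v ∣ ≡ d)) →
    IsInducedPath (InWindow a b) A
  window-is-path a b A A⇔ = length-of-run , position , injective , in-window , onto , adjacency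
    where
    first : ℕ
    first = threshold a

    length-of-run : ℕ
    length-of-run = threshold b ∸ first

    position : Fin length-of-run → ℕ
    position x = term (first + toℕ x)

    in-window : ∀ x → InWindow a b (position x)
    in-window x = from term-in-window (m≤m+n first (toℕ x) , +-<-∸ first (toℕ<n x))

    injective : ∀ {x y} → position x ≡ position y → x ≡ y
    injective e = toℕ-injective (+-cancelˡ-≡ first _ _ (term-injective e))

    onto : ∀ v → InWindow a b v → ∃[ x ] position x ≡ v
    onto v wv = fromℕ< offset<length , (begin
      term (first + toℕ (fromℕ< offset<length)) ≡⟨ cong (λ o → term (first + o)) (toℕ-fromℕ< offset<length) ⟩
      term (first + (v / d ∸ first))             ≡⟨ cong term (m+[n∸m]≡n first≤q) ⟩
      term (v / d)                               ≡⟨ v≡term ⟩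
      v                                          ∎)
      where
      open ≡-Reasoning
      v≡term : term (v / d) ≡ v
      v≡term = residue⇒term (proj₂ wv)
      range : first ≤ v / d × v / d < threshold b
      range = to term-in-window (subst (InWindow a b) (sym v≡term) wv)
      first≤q : first ≤ v / d
      first≤q = proj₁ range
      offset<length : v / d ∸ first < length-of-run
      offset<length = ∸-monoˡ-< (proj₂ range) first≤q

    adjacency : ∀ x y → A (position x) (position y) ⇔ (∣ toℕ x - toℕ y ∣ ≡ 1)
    adjacency x y = mk⇔
      (λ adj → to (*-≡-self⇔1 _ d) (trans (sym index-distance) (to A⇔xy adj)))
      (λ gap≡1 → from A⇔xy (trans index-distance (from (*-≡-self⇔1 _ d) gap≡1)))
      where
      A⇔xy : A (position x) (position y) ⇔ (∣ position x - position y ∣ ≡ d)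
      A⇔xy = A⇔ (in-window x) (in-window y)
      index-distance : ∣ position x - position y ∣ ≡ ∣ toℕ x - toℕ y ∣ * d
      index-distance = trans (term-distance (first + toℕ x) (first + toℕ y))
                             (cong (_* d) (∣m+n-m+o∣≡∣n-o∣ first (toℕ x) (toℕ y)))

proposition2 : (n k l : ℕ) → 0 < l → l < k → {{_ : NonZero (k ∸ l)}} →
    ((r : ℕ) → r < k ∸ l → IsInducedPath (InP n k l r) (Adj n k l))
    × ((i : ℕ) → IsVertex n k i → ∃[ r ] (r < k ∸ l × InP n k l r i))
    × ((i j : ℕ) → IsVertex n k i → IsVertex n k j → Adj n k l i j →
    ∃[ r ] (r < k ∸ l × InP n k l r i × InP n k l r j))
proposition2 n k l 0<l l<k =
    -- P_r is the window [k, n) of the residue class r mod d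
    (λ r r<d → Progression.window-is-path d r r<d k n (Adj n k l)
                 (λ wu wv → adjacent⇔distance 0<l l≤k (proj₁ wu) (proj₁ wv)))
  , (λ i vi → i % d , m%n<n i d , vi , refl)
    -- adjacent vertices are at distance d, hence in the same P_r
  , λ i j vi vj adj → i % d , m%n<n i d , (vi , refl) ,
      (vj , sym (same-residue-at-distance i j (to (adjacent⇔distance 0<l l≤k vi vj) adj)))
  where
  d : ℕ
  d = k ∸ l
  l≤k : l ≤ k
  l≤k = <⇒≤ l<k
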